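{- For every integer $n\ge 1$, the cardinality of the set $B(n)$ equals the $n$-th Fibonacci number $F_n$, where $F_1=F_2=1$ and $F_n=F_{n-1}+F_{n-2}$ for $n\ge 3$.
   Context: The sets $B(n)$ of finite integer vectors are defined recursively: $B(1)=\{(1)\}$, $B(2)=\{(1,1)\}$, and for $n\ge 3$, $B(n)=C(n)\cup D(n)$, where $C(n)=\{(1,t_1,\dots,t_s,1) : (1,t_1,\dots,t_s)\in B(n-1)\}$ and $D(n)=\{(1,t_1,\dots,t_{s-1},t_s+1) : (1,t_1,\dots,t_s)\in B(n-1) \text{ with } t_{s-1}>1 \text{ or } s=1\}$. -}

module Defs where

open import Data.Nat using (ℕ; zero; suc; _+_; _<_; _≟_)
open import Data.Nat.Properties using (_<?_)
open import Data.List using (List; []; _∷_; _++_; _∷ʳ_; concatMap; length; deduplicate)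
open import Data.List.Properties using (≡-dec)
open import Relation.Nullary using (yes; no)

F : ℕ → ℕ
F zero = 0
F (suc zero) = 1
F (suc (suc n)) = F (suc n) + F n

cStep : List ℕ → List (List ℕ)
cStep (1 ∷ ts) = ((1 ∷ ts) ∷ʳ 1) ∷ []
cStep _ = []

incLast : ℕ → List ℕ → List ℕ
incLast t [] = suc t ∷ []
incLast t (u ∷ us) = t ∷ incLast u us

secondLast : ℕ → ℕ → List ℕ → ℕ
secondLast a b [] = a
secondLast a b (c ∷ cs) = secondLast b c cs

dTail : List ℕ → List (List ℕ)
dTail [] = []
dTail (t ∷ []) = (1 ∷ suc t ∷ []) ∷ []
dTail (a ∷ b ∷ cs) with 1 <? secondLast a b cs
... | yes _ = (1 ∷ incLast a (b ∷ cs)) ∷ []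
... | no _ = []

dStep : List ℕ → List (List ℕ)
dStep (1 ∷ ts) = dTail ts
dStep _ = []

-- B n as a list of vectors (vectors = lists of naturals); B 0 is unused (empty).
B : ℕ → List (List ℕ)
B zero = []
B (suc zero) = (1 ∷ []) ∷ []
B (suc (suc zero)) = (1 ∷ 1 ∷ []) ∷ []
B (suc (suc (suc n))) = concatMap cStep (B (suc (suc n))) ++ concatMap dStep (B (suc (suc n)))

card : List (List ℕ) → ℕ
card xs = length (deduplicate (≡-dec _≟_) xs)

-- Every vector of B(n), n ≥ 2, has the form (1, xs, z) with z ≥ 1, written 1 ∷ xs ∷ʳ z,
-- and whether D applies to it depends only on xs: it does iff xs is empty or ends in an
-- entry > 1.  Hence D applies to every D-image (1, xs, z+1) and to its C-image
-- (1, xs, z+1, 1), but never to the C-image (1, xs, z, 1, 1) of a C-image.  Writing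
-- d(n) = |D(B(n))|, this gives |B(n+1)| = |B(n)| + d(n) and d(n+2) = d(n+1) + d(n), the
-- Fibonacci recursion.  C and D are injective and their images are disjoint (C-images end
-- in 1, D-images in an entry ≥ 2), so the list B n has no repetitions.
module Submission where

open import Defs
open import Data.Bool using (Bool; true; false; if_then_else_)
open import Data.Nat using (ℕ; zero; suc; _+_; _<ᵇ_; _≟_)
open import Data.Nat.Properties using (_<?_; +-comm)
open import Data.List using (List; []; _∷_; _++_; _∷ʳ_; concatMap; map; length; deduplicate; initLast; _∷ʳ′_)
open import Data.List.Properties using (≡-dec; length-++; length-map; concatMap-++; filter-all; ∷ʳ-injective; ∷ʳ-injectiveˡ; ∷ʳ-injectiveʳ)
open import Data.List.Membership.Propositional using (_∈_)
open import Data.List.Membership.Propositional.Properties using (∈-map⁻)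
open import Data.List.Relation.Unary.All as All using (All; []; _∷_)
import Data.List.Relation.Unary.All.Properties as All
open import Data.List.Relation.Unary.AllPairs as AllPairs using ([]; _∷_)
import Data.List.Relation.Unary.AllPairs.Properties as AllPairs
open import Data.List.Relation.Unary.Any using (here; there)
open import Data.List.Relation.Unary.Unique.Propositional using (Unique)
import Data.List.Relation.Unary.Unique.Propositional.Properties as Unique
open import Data.List.Relation.Binary.Disjoint.Propositional using (Disjoint)
open import Data.Product using (∃₂; _×_; _,_)
open import Function using (_∘_)
open import Relation.Nullary using (yes; no; ¬?)
open import Relation.Nullary.Decidable using (dec-true; dec-false)
open import Relation.Binary.Definitions using (DecidableEquality)
open import Relation.Binary.PropositionalEquality using (_≡_; _≢_; refl; sym; trans; cong; cong₂; subst; module ≡-Reasoning)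

private
  variable
    A A′ : Set
    P : A → Set
    f : A → List A′
    xs : List A

deduplicate-unique : (_≟ᴬ_ : DecidableEquality A) → Unique xs → deduplicate _≟ᴬ_ xs ≡ xs
deduplicate-unique _≟ᴬ_ [] = refl
deduplicate-unique {xs = x ∷ _} _≟ᴬ_ (x∉ ∷ u)
  rewrite deduplicate-unique _≟ᴬ_ u = cong (x ∷_) (filter-all (¬? ∘ (x ≟ᴬ_)) x∉)

all-concatMap⁺ : All (All P ∘ f) xs → All P (concatMap f xs)
all-concatMap⁺ = All.concat⁺ ∘ All.map⁺

concatMap-[] : All (λ x → f x ≡ []) xs → concatMap f xs ≡ []
concatMap-[] [] = refl
concatMap-[] (e ∷ es) rewrite e = concatMap-[] es

length-concatMap-singletons : All (λ x → length (f x) ≡ 1) xs → length (concatMap f xs) ≡ length xs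
length-concatMap-singletons [] = refl
length-concatMap-singletons {f = f} {xs = x ∷ _} (e ∷ es) =
  trans (length-++ (f x)) (cong₂ _+_ e (length-concatMap-singletons es))

all-if-singleton : ∀ b {x : A} → (b ≡ true → P x) → All P (if b then x ∷ [] else [])
all-if-singleton true  px = px refl ∷ []
all-if-singleton false _  = []

∈-if-singleton : ∀ b {x y : A} → y ∈ (if b then x ∷ [] else []) → y ≡ x
∈-if-singleton true (here e) = e
∈-if-singleton true (there ())

unique-if-singleton : ∀ b {x : A} → Unique (if b then x ∷ [] else [])
unique-if-singleton true  = [] ∷ []
unique-if-singleton false = []

lastOf : ℕ → List ℕ → ℕ
lastOf x [] = x
lastOf _ (y ∷ ys) = lastOf y ys

extendable : List ℕ → Bool
extendable [] = true
extendable (x ∷ xs) = 1 <ᵇ lastOf x xs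

lastOf-∷ʳ : ∀ x xs z → lastOf x (xs ∷ʳ z) ≡ z
lastOf-∷ʳ x [] z = refl
lastOf-∷ʳ x (y ∷ ys) z = lastOf-∷ʳ y ys z

extendable-∷ʳ : ∀ xs y → extendable (xs ∷ʳ y) ≡ (1 <ᵇ y)
extendable-∷ʳ [] y = refl
extendable-∷ʳ (x ∷ xs) y = cong (1 <ᵇ_) (lastOf-∷ʳ x xs y)

secondLast-∷ʳ : ∀ a b cs z → secondLast a b (cs ∷ʳ z) ≡ lastOf b cs
secondLast-∷ʳ a b [] z = refl
secondLast-∷ʳ a b (c ∷ cs) z = secondLast-∷ʳ b c cs z

incLast-∷ʳ : ∀ t ts z → incLast t (ts ∷ʳ z) ≡ t ∷ ts ∷ʳ suc z
incLast-∷ʳ t [] z = refl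
incLast-∷ʳ t (u ∷ us) z = cong (t ∷_) (incLast-∷ʳ u us z)

dTail-∷∷ : ∀ a b cs →
  dTail (a ∷ b ∷ cs) ≡ (if 1 <ᵇ secondLast a b cs then (1 ∷ incLast a (b ∷ cs)) ∷ [] else [])
-- `does (1 <? s)` computes to `1 <ᵇ s`, so a `with` on the decision does not reach the right-hand side.
dTail-∷∷ a b cs with 1 <? secondLast a b cs
... | yes 1<s rewrite dec-true (1 <? secondLast a b cs) 1<s = refl
... | no 1≮s rewrite dec-false (1 <? secondLast a b cs) 1≮s = refl

dStep-snoc : ∀ xs z → dStep (1 ∷ xs ∷ʳ z) ≡ (if extendable xs then (1 ∷ xs ∷ʳ suc z) ∷ [] else [])
dStep-snoc [] z = refl
dStep-snoc (a ∷ []) z = dTail-∷∷ a z []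
dStep-snoc (a ∷ b ∷ bs) z =
  trans (dTail-∷∷ a b (bs ∷ʳ z))
        (cong₂ (λ s w → if 1 <ᵇ s then (1 ∷ w) ∷ [] else [])
               (secondLast-∷ʳ a b bs z) (incLast-∷ʳ a (b ∷ bs) z))

dStep-penultimate-1 : ∀ xs z → dStep (1 ∷ xs ∷ʳ 1 ∷ʳ z) ≡ []
dStep-penultimate-1 xs z rewrite dStep-snoc (xs ∷ʳ 1) z | extendable-∷ʳ xs 1 = refl

dStep-penultimate-≥2 : ∀ xs y z →
  dStep (1 ∷ xs ∷ʳ suc (suc y) ∷ʳ z) ≡ (1 ∷ xs ∷ʳ suc (suc y) ∷ʳ suc z) ∷ []
dStep-penultimate-≥2 xs y z rewrite dStep-snoc (xs ∷ʳ suc (suc y)) z | extendable-∷ʳ xs (suc (suc y)) = refl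

∈-dStep : ∀ {v w} → w ∈ dStep v → ∃₂ λ xs z → v ≡ 1 ∷ xs ∷ʳ z × w ≡ 1 ∷ xs ∷ʳ suc z
∈-dStep {[]} ()
∈-dStep {zero ∷ _} ()
∈-dStep {suc (suc _) ∷ _} ()
∈-dStep {1 ∷ ts} w∈ with initLast ts
∈-dStep {1 ∷ .[]} () | []
∈-dStep {1 ∷ .(xs ∷ʳ z)} w∈ | xs ∷ʳ′ z =
  xs , z , refl , ∈-if-singleton (extendable xs) (subst (_ ∈_) (dStep-snoc xs z) w∈)

dStep-disjoint : ∀ {x y} → x ≢ y → Disjoint (dStep x) (dStep y)
dStep-disjoint {x} {y} x≢y (w∈x , w∈y) with ∈-dStep {x} w∈x | ∈-dStep {y} w∈y
... | xs , z , refl , refl | xs′ , z′ , refl , e with refl , refl ← ∷ʳ-injective (1 ∷ xs) (1 ∷ xs′) e = x≢y refl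

data Admissible : List ℕ → Set where
  admissible : ∀ xs z → Admissible (1 ∷ xs ∷ʳ suc z)

data DImage : List ℕ → Set where
  dImage : ∀ xs z → extendable xs ≡ true → DImage (1 ∷ xs ∷ʳ suc (suc z))

∷ʳ1-admissible : ∀ {v} → Admissible v → Admissible (v ∷ʳ 1)
∷ʳ1-admissible (admissible xs z) = admissible (xs ∷ʳ suc z) 0

dImage-admissible : ∀ {w} → DImage w → Admissible w
dImage-admissible (dImage xs z _) = admissible xs (suc z)

dStep-dImage : ∀ {v} → Admissible v → All DImage (dStep v)
dStep-dImage (admissible xs z) =
  subst (All DImage) (sym (dStep-snoc xs (suc z))) (all-if-singleton (extendable xs) (dImage xs z))

dStep-unique : ∀ {v} → Admissible v → Unique (dStep v)
dStep-unique (admissible xs z) rewrite dStep-snoc xs (suc z) = unique-if-singleton (extendable xs)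

length-dStep-dImage : ∀ {w} → DImage w → length (dStep w) ≡ 1
length-dStep-dImage (dImage xs z e) rewrite dStep-snoc xs (suc (suc z)) | e = refl

length-dStep-dImage-∷ʳ1 : ∀ {w} → DImage w → length (dStep (w ∷ʳ 1)) ≡ 1
length-dStep-dImage-∷ʳ1 (dImage xs z _) = cong length (dStep-penultimate-≥2 xs z 1)

dStep-∷ʳ1∷ʳ1 : ∀ {v} → Admissible v → dStep (v ∷ʳ 1 ∷ʳ 1) ≡ []
dStep-∷ʳ1∷ʳ1 (admissible xs z) = dStep-penultimate-1 (xs ∷ʳ suc z) 1

dImage-≢-∷ʳ1 : ∀ {w} → DImage w → ∀ u → w ≢ u ∷ʳ 1
dImage-≢-∷ʳ1 (dImage xs z _) u e with () ← ∷ʳ-injectiveʳ (1 ∷ xs) u e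

C D : List (List ℕ) → List (List ℕ)
C = concatMap cStep
D = concatMap dStep

length-D-++ : ∀ us vs → length (D (us ++ vs)) ≡ length (D us) + length (D vs)
length-D-++ us vs = trans (cong length (concatMap-++ dStep us vs)) (length-++ (D us))

C-map : ∀ {vs} → All Admissible vs → C vs ≡ map (_∷ʳ 1) vs
C-map [] = refl
C-map (admissible xs z ∷ adm) = cong (_ ∷_) (C-map adm)

module _ {vs : List (List ℕ)} (adm : All Admissible vs) where

  D-dImage : All DImage (D vs)
  D-dImage = all-concatMap⁺ (All.map dStep-dImage adm)

  C-admissible : All Admissible (C vs)
  C-admissible rewrite C-map adm = All.map⁺ (All.map ∷ʳ1-admissible adm)

  D-admissible : All Admissible (D vs)
  D-admissible = All.map dImage-admissible D-dImage

  C-unique : Unique vs → Unique (C vs)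
  C-unique u rewrite C-map adm = Unique.map⁺ (λ {x} {y} → ∷ʳ-injectiveˡ x y) u

  D-unique : Unique vs → Unique (D vs)
  D-unique u = Unique.concat⁺ (All.map⁺ (All.map dStep-unique adm))
                              (AllPairs.map⁺ (AllPairs.map dStep-disjoint u))

  C-D-disjoint : Disjoint (C vs) (D vs)
  C-D-disjoint (w∈C , w∈D) rewrite C-map adm with ∈-map⁻ (_∷ʳ 1) w∈C
  ... | u , _ , w≡ = dImage-≢-∷ʳ1 (All.lookup D-dImage w∈D) u w≡

  length-C : length (C vs) ≡ length vs
  length-C = trans (cong length (C-map adm)) (length-map (_∷ʳ 1) vs)

  length-D-D : length (D (D vs)) ≡ length (D vs)
  length-D-D = length-concatMap-singletons (All.map length-dStep-dImage D-dImage)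

  length-D-C-D : length (D (C (D vs))) ≡ length (D vs)
  length-D-C-D rewrite C-map D-admissible =
    trans (length-concatMap-singletons (All.map⁺ (All.map length-dStep-dImage-∷ʳ1 D-dImage)))
          (length-map (_∷ʳ 1) (D vs))

  D-C-C≡[] : D (C (C vs)) ≡ []
  D-C-C≡[] rewrite C-map C-admissible | C-map adm =
    concatMap-[] (All.map⁺ (All.map⁺ (All.map dStep-∷ʳ1∷ʳ1 adm)))

  step-admissible : All Admissible (C vs ++ D vs)
  step-admissible = All.++⁺ C-admissible D-admissible

  step-unique : Unique vs → Unique (C vs ++ D vs)
  step-unique u = Unique.++⁺ (C-unique u) (D-unique u) C-D-disjoint

  length-step : length (C vs ++ D vs) ≡ length vs + length (D vs)
  length-step = trans (length-++ (C vs)) (cong (_+ length (D vs)) length-C)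

  length-D-step : length (D (C vs ++ D vs)) ≡ length (D (C vs)) + length (D vs)
  length-D-step = trans (length-D-++ (C vs) (D vs)) (cong (length (D (C vs)) +_) length-D-D)

  length-D-C-step : length (D (C (C vs ++ D vs))) ≡ length (D vs)
  length-D-C-step = begin
    length (D (C (C vs ++ D vs)))                  ≡⟨ cong (length ∘ D) (concatMap-++ cStep (C vs) (D vs)) ⟩
    length (D (C (C vs) ++ C (D vs)))              ≡⟨ length-D-++ (C (C vs)) (C (D vs)) ⟩
    length (D (C (C vs))) + length (D (C (D vs)))  ≡⟨ cong₂ _+_ (cong length D-C-C≡[]) length-D-C-D ⟩
    length (D vs)                                  ∎
    where open ≡-Reasoning

B-admissible : ∀ n → All Admissible (B (2 + n))
B-admissible zero = admissible [] 0 ∷ []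
B-admissible (suc n) = step-admissible (B-admissible n)

B-unique : ∀ n → Unique (B (suc n))
B-unique zero = [] ∷ []
B-unique (suc zero) = [] ∷ []
B-unique (suc (suc n)) = step-unique (B-admissible n) (B-unique (suc n))

length-D-B : ∀ n → length (D (B (2 + n))) ≡ F (suc n)
length-D-B zero = refl
length-D-B (suc zero) = refl
length-D-B (suc (suc n)) = begin
  length (D (B (4 + n)))
    ≡⟨ length-D-step (B-admissible (suc n)) ⟩
  length (D (C (B (3 + n)))) + length (D (B (3 + n)))
    ≡⟨ cong₂ _+_ (length-D-C-step (B-admissible n)) (length-D-B (suc n)) ⟩
  length (D (B (2 + n))) + F (2 + n)
    ≡⟨ cong (_+ F (2 + n)) (length-D-B n) ⟩
  F (1 + n) + F (2 + n)
    ≡⟨ +-comm (F (1 + n)) (F (2 + n)) ⟩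
  F (3 + n)
    ∎
  where open ≡-Reasoning

length-B : ∀ n → length (B (suc n)) ≡ F (suc n)
length-B zero = refl
length-B (suc zero) = refl
length-B (suc (suc n)) = trans (length-step (B-admissible n)) (cong₂ _+_ (length-B (suc n)) (length-D-B n))

lemma2p3 : (n : ℕ) → card (B (suc n)) ≡ F (suc n)
lemma2p3 n = trans (cong length (deduplicate-unique (≡-dec _≟_) (B-unique n))) (length-B n)
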